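{- Every quilt with no vertices of degree two has a convenient graph.
   Context: For a plane graph $G$ whose infinite region is bounded by a cycle $C$, the deficiency of $G$ is $\sum_{v\in V(G)-V(C)}\max\{6-\deg(v),0\}$. A quilt is a simple plane graph $G$ whose infinite region is bounded by a cycle $C$, such that $G$ has deficiency at most five and every finite region of $G$ is bounded by a triangle. If exactly one vertex of $C$ has degree three (in $G$) and all other vertices of $C$ have degree exactly four, then $C$ is a convenient graph; otherwise a convenient graph is a subpath of $C$ with at least one edge whose two ends have degree exactly three and whose internal vertices have degree exactly four. -}

module Defs where

open import Data.Nat using (ℕ; zero; suc; _+_; _*_; _∸_; _≤_; _<_; _≤?_)
open import Data.Fin using (Fin; toℕ) renaming (_≟_ to _≟ᶠ_)
open import Data.Fin.Properties using (any?; all?)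
open import Data.List using (List; length; filter; map; allFin)
open import Data.Nat.ListAction using (sum)
open import Data.Product using (Σ; ∃; _×_; _,_)
open import Relation.Nullary using (¬_; Dec; yes; no)
open import Relation.Binary.PropositionalEquality using (_≡_; _≢_)
open import Function.Definitions using (Injective)

iter : ∀ {A : Set} → (A → A) → ℕ → A → A
iter f zero    x = x
iter f (suc i) x = f (iter f i x)

ifDec : ∀ {P : Set} → Dec P → ℕ → ℕ → ℕ
ifDec (yes _) a b = a
ifDec (no  _) a b = b

data Reach {m : ℕ} (σ α : Fin m → Fin m) : Fin m → Fin m → Set where
  here  : ∀ {d} → Reach σ α d d
  stepσ : ∀ {d e} → Reach σ α (σ d) e → Reach σ α d e
  stepα : ∀ {d e} → Reach σ α (α d) e → Reach σ α d e

-- A (finite, connected) plane graph, represented combinatorially by a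
-- rotation system (combinatorial map) of genus 0, with a distinguished
-- dart `outer` whose face is the infinite region.
--   darts : Fin m, vertices : Fin n, tail : Fin m → Fin n,
--   α : the edge involution (reverses a dart),
--   σ : rotation of darts around their tail vertex,
--   φ = σ ∘ α : face permutation (faces = φ-orbits).
record PlaneMap : Set where
  field
    n m   : ℕ
    tail  : Fin m → Fin n
    α σ   : Fin m → Fin m
    α-invol   : ∀ d → α (α d) ≡ d
    α-nofix   : ∀ d → α d ≢ d
    σ-inj     : Injective _≡_ _≡_ σ
    σ-tail    : ∀ d → tail (σ d) ≡ tail d
    σ-trans   : ∀ d e → tail d ≡ tail e → ∃ λ i → iter σ i d ≡ e
    tail-surj : ∀ v → ∃ λ d → tail d ≡ v
    connected : ∀ d e → Reach σ α d e
    no-loop   : ∀ d → tail (α d) ≢ tail d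
    no-multi  : ∀ d e → tail d ≡ tail e → tail (α d) ≡ tail (α e) → d ≡ e

  φ : Fin m → Fin m
  φ d = σ (α d)

  faceRep? : (d : Fin m) → Dec (∀ (i : Fin m) → toℕ d ≤ toℕ (iter φ (toℕ i) d))
  faceRep? d = all? (λ i → toℕ d ≤? toℕ (iter φ (toℕ i) d))

  faces : ℕ
  faces = length (filter faceRep? (allFin m))

  deg : Fin n → ℕ
  deg v = length (filter (λ d → tail d ≟ᶠ v) (allFin m))

  -- Euler's formula V - E + F = 2 with E = m/2 (genus 0: the map is planar)
  field
    planar : 2 * n + 2 * faces ≡ m + 4

-- A quilt: a plane graph whose infinite region is bounded by a cycle C
-- (the face of dart `outer`, of length k), all finite regions triangles,
-- and deficiency at most five.
record Quilt : Set where
  field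
    G : PlaneMap
  open PlaneMap G public
  field
    outer : Fin m
    k     : ℕ
    k≥3       : 3 ≤ k
    k-closes  : iter φ k outer ≡ outer
    k-minimal : ∀ j → 1 ≤ j → j < k → iter φ j outer ≢ outer

  -- the i-th vertex of the boundary cycle C (indices taken modulo k)
  cv : ℕ → Fin n
  cv i = tail (iter φ i outer)

  field
    cycle-distinct : ∀ i j → i < k → j < k → cv i ≡ cv j → i ≡ j
    finite-triangles : ∀ d → ¬ (∃ λ (i : Fin k) → iter φ (toℕ i) outer ≡ d)
                           → iter φ 3 d ≡ d

  onC? : (v : Fin n) → Dec (∃ λ (i : Fin k) → cv (toℕ i) ≡ v)
  onC? v = any? (λ i → cv (toℕ i) ≟ᶠ v)

  defTerm : Fin n → ℕ
  defTerm v = ifDec (onC? v) 0 (6 ∸ deg v)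

  deficiency : ℕ
  deficiency = sum (map defTerm (allFin n))

  field
    deficiency≤5 : deficiency ≤ 5

HasConvenientGraph : Quilt → Set
HasConvenientGraph Q =
    -- exactly one vertex of C has degree 3, all others degree 4 (then C is convenient)
    (Σ ℕ λ a → a < k × deg (cv a) ≡ 3 ×
       (∀ b → b < k → b ≢ a → deg (cv b) ≡ 4))
  ⊎ -- a subpath cv a, cv (a+1), ..., cv (a+j) of C with 1 ≤ j < k edges,
    (Σ ℕ λ a → Σ ℕ λ j → 1 ≤ j × j < k ×
       deg (cv a) ≡ 3 × deg (cv (a + j)) ≡ 3 ×
       (∀ t → 1 ≤ t → t < j → deg (cv (a + t)) ≡ 4))
  where open Quilt Q
        open import Data.Sum using (_⊎_)

-- Every vertex of C has degree at least 2, hence at least 3. Counting darts face by face (one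
-- face of length k, all others triangles), Euler's formula and the deficiency bound give
-- Σ_{v ∈ C} deg v ≤ 4k − 1, so some vertex of C has degree 3. Walk once around C from it: a
-- stretch between consecutive degree-3 vertices that contains a vertex of degree at least 5
-- contributes at least 4 per vertex to the sum, so not all stretches can be of that kind, and a
-- stretch made of degree-4 vertices only is a convenient graph (the whole of C if it is the
-- only degree-3 vertex).

module Submission where

open import Defs
open import Data.Fin using (Fin; zero; suc; toℕ; fromℕ<) renaming (_≟_ to _≟ᶠ_)
open import Data.Fin.Properties using (toℕ<n; toℕ-fromℕ<; toℕ-injective; injective⇒≤; any?)
  renaming (suc-injective to sucᶠ-injective)
open import Data.List using ([]; _∷_; length; filter; map; tabulate)
import Data.Nat.ListAction as List
open import Data.Nat
open import Data.Nat.DivMod using (_%_; _/_; m≡m%n+[m/n]*n; m%n<n)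
open import Data.Nat.Properties
open import Algebra.Properties.Semiring.Sum +-*-semiring
  using (sum; sum-syntax; sum-cong-≗; ∑-distrib-+; ∑-comm; *-distribˡ-sum; *-distribʳ-sum)
open import Data.Nat.Tactic.RingSolver using (solve)
open import Data.Product using (Σ; ∃; _×_; _,_; proj₁; proj₂)
open import Data.Sum using (_⊎_; inj₁; inj₂; [_,_])
open import Function using (_∘_)
open import Function.Definitions using (Injective)
open import Relation.Binary.Definitions using (tri<; tri≈; tri>)
open import Relation.Binary.PropositionalEquality
  using (_≡_; _≢_; refl; sym; trans; cong; cong₂; subst; subst₂; module ≡-Reasoning)
open import Relation.Nullary using (¬_; Dec; yes; no; contradiction)
open import Relation.Unary using (Decidable)

-- Finite sums

sum-const : ∀ n c → ∑[ i < n ] c ≡ n * c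
sum-const zero    c = refl
sum-const (suc n) c = cong (c +_) (sum-const n c)

sum-mono-≤ : ∀ {n} {f g : Fin n → ℕ} → (∀ i → f i ≤ g i) → sum f ≤ sum g
sum-mono-≤ {zero}  f≤g = z≤n
sum-mono-≤ {suc n} f≤g = +-mono-≤ (f≤g zero) (sum-mono-≤ (f≤g ∘ suc))

sum-supported-at : ∀ {n} (f : Fin n → ℕ) i → (∀ j → j ≢ i → f j ≡ 0) → sum f ≡ f i
sum-supported-at {suc n} f zero    f≡0 = begin
  f zero + ∑[ j < n ] f (suc j)  ≡⟨ cong (f zero +_) (sum-cong-≗ (λ j → f≡0 (suc j) (λ ()))) ⟩
  f zero + ∑[ j < n ] 0          ≡⟨ cong (f zero +_) (trans (sum-const n 0) (*-zeroʳ n)) ⟩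
  f zero + 0                     ≡⟨ +-identityʳ (f zero) ⟩
  f zero                         ∎
  where open ≡-Reasoning
sum-supported-at {suc n} f (suc i) f≡0 =
  cong₂ _+_ (f≡0 zero (λ ())) (sum-supported-at (f ∘ suc) i (λ j j≢i → f≡0 (suc j) (j≢i ∘ sucᶠ-injective)))

≤-sum : ∀ {n} (f : Fin n → ℕ) i → f i ≤ sum f
≤-sum f zero    = m≤m+n (f zero) _
≤-sum f (suc i) = ≤-trans (≤-sum (f ∘ suc) i) (m≤n+m _ (f zero))

pair≤sum : ∀ {n} (f : Fin n → ℕ) {i j} → i ≢ j → f i + f j ≤ sum f
pair≤sum f {zero}  {zero}  i≢j = contradiction refl i≢j
pair≤sum f {zero}  {suc j} i≢j = +-monoʳ-≤ (f zero) (≤-sum (f ∘ suc) j)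
pair≤sum f {suc i} {zero}  i≢j =
  subst (_≤ sum f) (+-comm (f zero) (f (suc i))) (+-monoʳ-≤ (f zero) (≤-sum (f ∘ suc) i))
pair≤sum f {suc i} {suc j} i≢j = ≤-trans (pair≤sum (f ∘ suc) (i≢j ∘ cong suc)) (m≤n+m _ (f zero))

x≤1∧y≤n∧x+y≡1+n : ∀ {x y n} → x ≤ 1 → y ≤ n → x + y ≡ suc n → x ≡ 1 × y ≡ n
x≤1∧y≤n∧x+y≡1+n {0}           _        y≤n y≡1+n   = contradiction (≤-reflexive (sym y≡1+n)) (<⇒≱ (s≤s y≤n))
x≤1∧y≤n∧x+y≡1+n {1}           _        _   1+y≡1+n = refl , suc-injective 1+y≡1+n
x≤1∧y≤n∧x+y≡1+n {suc (suc _)} (s≤s ()) _   _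

all≤1∧sum≡n⇒all≡1 : ∀ {n} (f : Fin n → ℕ) → (∀ i → f i ≤ 1) → sum f ≡ n → ∀ i → f i ≡ 1
all≤1∧sum≡n⇒all≡1 {suc n} f f≤1 Σf≡1+n = λ where
    zero    → proj₁ head∧tail
    (suc i) → all≤1∧sum≡n⇒all≡1 (f ∘ suc) (f≤1 ∘ suc) (proj₂ head∧tail) i
  where
  tail≤n : sum (f ∘ suc) ≤ n
  tail≤n = subst (sum (f ∘ suc) ≤_) (trans (sum-const n 1) (*-identityʳ n)) (sum-mono-≤ (f≤1 ∘ suc))
  head∧tail : f zero ≡ 1 × sum (f ∘ suc) ≡ n
  head∧tail = x≤1∧y≤n∧x+y≡1+n (f≤1 zero) tail≤n Σf≡1+n

𝟙 : ∀ {P : Set} → Dec P → ℕ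
𝟙 P? = ifDec P? 1 0

𝟙-yes : ∀ {P : Set} (P? : Dec P) → P → 𝟙 P? ≡ 1
𝟙-yes (yes _) _ = refl
𝟙-yes (no ¬p) p = contradiction p ¬p

𝟙-no : ∀ {P : Set} (P? : Dec P) → ¬ P → 𝟙 P? ≡ 0
𝟙-no (yes p) ¬p = contradiction p ¬p
𝟙-no (no _)  _  = refl

𝟙≤1 : ∀ {P : Set} (P? : Dec P) → 𝟙 P? ≤ 1
𝟙≤1 (yes _) = ≤-refl
𝟙≤1 (no _)  = z≤n

ifDec-cong : ∀ {P Q : Set} → (P → Q) → (Q → P) → (P? : Dec P) (Q? : Dec Q) →
             ∀ a b → ifDec P? a b ≡ ifDec Q? a b
ifDec-cong P→Q Q→P (yes _) (yes _) a b = refl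
ifDec-cong P→Q Q→P (yes p) (no ¬q) a b = contradiction (P→Q p) ¬q
ifDec-cong P→Q Q→P (no ¬p) (yes q) a b = contradiction (Q→P q) ¬p
ifDec-cong P→Q Q→P (no _)  (no _)  a b = refl

length-filter-tabulate : ∀ {A : Set} {P : A → Set} (P? : Decidable P) {n} (g : Fin n → A) →
                         length (filter P? (tabulate g)) ≡ ∑[ i < n ] 𝟙 (P? (g i))
length-filter-tabulate P? {zero}  g = refl
length-filter-tabulate P? {suc n} g with P? (g zero)
... | yes _ = cong suc (length-filter-tabulate P? (g ∘ suc))
... | no  _ = length-filter-tabulate P? (g ∘ suc)

sum-map-tabulate : ∀ {A : Set} (f : A → ℕ) {n} (g : Fin n → A) →
                   List.sum (map f (tabulate g)) ≡ ∑[ i < n ] f (g i)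
sum-map-tabulate f {zero}  g = refl
sum-map-tabulate f {suc n} g = cong (f (g zero) +_) (sum-map-tabulate f (g ∘ suc))

sum-select : ∀ {n} (c : Fin n) (w : Fin n → ℕ) → ∑[ v < n ] (𝟙 (c ≟ᶠ v) * w v) ≡ w c
sum-select c w = begin
  ∑[ v < _ ] (𝟙 (c ≟ᶠ v) * w v)  ≡⟨ sum-supported-at _ c (λ v v≢c → cong (_* w v) (𝟙-no (c ≟ᶠ v) (v≢c ∘ sym))) ⟩
  𝟙 (c ≟ᶠ c) * w c               ≡⟨ cong (_* w c) (𝟙-yes (c ≟ᶠ c) refl) ⟩
  w c + 0                        ≡⟨ +-identityʳ (w c) ⟩
  w c                            ∎
  where open ≡-Reasoning

module _ {N K : ℕ} (g : Fin K → Fin N) (g-injective : Injective _≡_ _≡_ g)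
         (inImage? : ∀ v → Dec (∃ λ i → g i ≡ v)) where

  𝟙-inImage : ∀ v → 𝟙 (inImage? v) ≡ ∑[ i < K ] 𝟙 (g i ≟ᶠ v)
  𝟙-inImage v with inImage? v
  ... | yes (i , gi≡v) = sym (trans (sum-supported-at _ i others) (𝟙-yes (g i ≟ᶠ v) gi≡v))
    where
    others : ∀ j → j ≢ i → 𝟙 (g j ≟ᶠ v) ≡ 0
    others j j≢i = 𝟙-no (g j ≟ᶠ v) (λ gj≡v → j≢i (g-injective (trans gj≡v (sym gi≡v))))
  ... | no  v∉ = sym (trans (sum-cong-≗ (λ i → 𝟙-no (g i ≟ᶠ v) (λ gi≡v → v∉ (i , gi≡v))))
                            (trans (sum-const K 0) (*-zeroʳ K)))

  sum-image : ∀ (w : Fin N → ℕ) → ∑[ v < N ] (𝟙 (inImage? v) * w v) ≡ ∑[ i < K ] w (g i)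
  sum-image w = begin
    ∑[ v < N ] (𝟙 (inImage? v) * w v)            ≡⟨ sum-cong-≗ {N} (λ v → cong (_* w v) (𝟙-inImage v)) ⟩
    ∑[ v < N ] ((∑[ i < K ] 𝟙 (g i ≟ᶠ v)) * w v)  ≡⟨ sum-cong-≗ {N} (λ v → *-distribʳ-sum {K} (w v) _) ⟩
    ∑[ v < N ] ∑[ i < K ] (𝟙 (g i ≟ᶠ v) * w v)    ≡⟨ ∑-comm (λ v i → 𝟙 (g i ≟ᶠ v) * w v) ⟩
    ∑[ i < K ] ∑[ v < N ] (𝟙 (g i ≟ᶠ v) * w v)    ≡⟨ sum-cong-≗ (λ i → sum-select (g i) w) ⟩
    ∑[ i < K ] w (g i)                            ∎
    where open ≡-Reasoning

  count-image : ∑[ v < N ] 𝟙 (inImage? v) ≡ K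
  count-image = begin
    ∑[ v < N ] 𝟙 (inImage? v)        ≡⟨ sum-cong-≗ {N} (λ v → sym (*-identityʳ _)) ⟩
    ∑[ v < N ] (𝟙 (inImage? v) * 1)  ≡⟨ sum-image (λ _ → 1) ⟩
    ∑[ i < K ] 1                     ≡⟨ trans (sum-const K 1) (*-identityʳ K) ⟩
    K                                ∎
    where open ≡-Reasoning

sum-∘-injective : ∀ {N} (π : Fin N → Fin N) → Injective _≡_ _≡_ π → (G : Fin N → ℕ) →
                  ∑[ d < N ] G (π d) ≡ sum G
sum-∘-injective {N} π π-injective G = begin
  ∑[ d < N ] G (π d)                 ≡⟨ sum-image π π-injective inImage? G ⟨
  ∑[ v < N ] (𝟙 (inImage? v) * G v)  ≡⟨ sum-cong-≗ (λ v → cong (_* G v) (surjective v)) ⟩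
  ∑[ v < N ] (1 * G v)               ≡⟨ sum-cong-≗ (λ v → +-identityʳ (G v)) ⟩
  sum G                              ∎
  where
  open ≡-Reasoning
  inImage? : ∀ v → Dec (∃ λ d → π d ≡ v)
  inImage? v = any? (λ d → π d ≟ᶠ v)
  -- π hits N points, each at most once, so it hits all of them
  surjective : ∀ v → 𝟙 (inImage? v) ≡ 1
  surjective = all≤1∧sum≡n⇒all≡1 _ (𝟙≤1 ∘ inImage?) (count-image π π-injective inImage?)

sumBelow : ℕ → (ℕ → ℕ) → ℕ
sumBelow k f = ∑[ i < k ] f (toℕ i)

sumBelow-cong : ∀ k {f g : ℕ → ℕ} → (∀ i → i < k → f i ≡ g i) → sumBelow k f ≡ sumBelow k g
sumBelow-cong k f≡g = sum-cong-≗ (λ i → f≡g (toℕ i) (toℕ<n i))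

sumBelow-suc : ∀ k (f : ℕ → ℕ) → sumBelow (suc k) f ≡ sumBelow k f + f k
sumBelow-suc zero    f = +-comm (f 0) 0
sumBelow-suc (suc k) f = trans (cong (f 0 +_) (sumBelow-suc k (f ∘ suc))) (sym (+-assoc (f 0) _ _))

sumBelow-single : ∀ k (f : ℕ → ℕ) {c} → c < k → (∀ i → i < k → i ≢ c → f i ≡ 0) → sumBelow k f ≡ f c
sumBelow-single k f {c} c<k f≡0 = trans (sum-supported-at _ (fromℕ< c<k) others) (cong f (toℕ-fromℕ< c<k))
  where
  others : ∀ i → i ≢ fromℕ< c<k → f (toℕ i) ≡ 0
  others i i≢c = f≡0 (toℕ i) (toℕ<n i) (λ i≡c → i≢c (toℕ-injective (trans i≡c (sym (toℕ-fromℕ< c<k)))))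

sumBelow-rotate : ∀ k (f : ℕ → ℕ) → (∀ i → f (i + k) ≡ f i) →
                  ∀ a → sumBelow k (λ s → f (a + s)) ≡ sumBelow k f
sumBelow-rotate k f f-periodic zero    = refl
sumBelow-rotate k f f-periodic (suc a) =
  trans (+-cancelʳ-≡ (f a) _ _ shift) (sumBelow-rotate k f f-periodic a)
  where
  open ≡-Reasoning
  shift : sumBelow k (λ s → f (suc a + s)) + f a ≡ sumBelow k (λ s → f (a + s)) + f a
  shift = begin
    sumBelow k (λ s → f (suc a + s)) + f a
      ≡⟨ cong₂ _+_ (sumBelow-cong k (λ s _ → cong f (sym (+-suc a s)))) (cong f (sym (+-identityʳ a))) ⟩
    sumBelow k (λ s → f (a + suc s)) + f (a + 0)
      ≡⟨ +-comm _ (f (a + 0)) ⟩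
    sumBelow (suc k) (λ s → f (a + s))
      ≡⟨ sumBelow-suc k (λ s → f (a + s)) ⟩
    sumBelow k (λ s → f (a + s)) + f (a + k)
      ≡⟨ cong (sumBelow k (λ s → f (a + s)) +_) (f-periodic a) ⟩
    sumBelow k (λ s → f (a + s)) + f a
      ∎

-- Cyclic sequences of average below 4

FourBetween : (ℕ → ℕ) → ℕ → ℕ → Set
FourBetween h a b = ∀ s → a < s → s < b → h s ≡ 4

Convenient : (ℕ → ℕ) → ℕ → Set
Convenient f k =
    (Σ ℕ λ a → a < k × f a ≡ 3 × (∀ b → b < k → b ≢ a → f b ≡ 4))
  ⊎ (Σ ℕ λ a → Σ ℕ λ j → 1 ≤ j × j < k × f a ≡ 3 × f (a + j) ≡ 3 ×
       (∀ t → 1 ≤ t → t < j → f (a + t) ≡ 4))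

-- The state after reading h 0, …, h (L ∸ 1): a run 3 4 ⋯ 4 3 has been seen, or the prefix
-- has average at least 4, except for a deficit of one owed to a last 3 followed only by 4s.
data Scan (h : ℕ → ℕ) (L : ℕ) : Set where
  run     : ∀ {a b} → a < b → b < L → h a ≡ 3 → h b ≡ 3 → FourBetween h a b → Scan h L
  pending : ∀ {p} → p < L → h p ≡ 3 → FourBetween h p L → 4 * L ≤ sumBelow L h + 1 → Scan h L
  heavy   : 4 * L ≤ sumBelow L h + 0 → Scan h L

3≤⇒≡3⊎≡4⊎5≤ : ∀ {x} → 3 ≤ x → x ≡ 3 ⊎ x ≡ 4 ⊎ 5 ≤ x
3≤⇒≡3⊎≡4⊎5≤ {0} ()
3≤⇒≡3⊎≡4⊎5≤ {1} (s≤s ())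
3≤⇒≡3⊎≡4⊎5≤ {2} (s≤s (s≤s ()))
3≤⇒≡3⊎≡4⊎5≤ {3} _ = inj₁ refl
3≤⇒≡3⊎≡4⊎5≤ {4} _ = inj₂ (inj₁ refl)
3≤⇒≡3⊎≡4⊎5≤ {suc (suc (suc (suc (suc _))))} _ = inj₂ (inj₂ (s≤s (s≤s (s≤s (s≤s (s≤s z≤n))))))

4*-suc-≤ : ∀ {L S d x d′} → 4 * L ≤ S + d → 4 + d ≤ x + d′ → 4 * suc L ≤ S + x + d′
4*-suc-≤ {L} {S} {d} {x} {d′} 4L≤S+d 4+d≤x+d′ = +-cancelʳ-≤ d _ _ (begin
  4 * suc L + d     ≡⟨ solve (L ∷ d ∷ []) ⟩
  4 * L + (4 + d)   ≤⟨ +-mono-≤ 4L≤S+d 4+d≤x+d′ ⟩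
  S + d + (x + d′)  ≡⟨ solve (S ∷ d ∷ x ∷ d′ ∷ []) ⟩
  S + x + d′ + d    ∎)
  where open ≤-Reasoning

scan : ∀ {h} → (∀ s → 3 ≤ h s) → ∀ L → Scan h L
scan     h≥3 zero    = heavy z≤n
scan {h} h≥3 (suc L) = step (scan h≥3 L) (3≤⇒≡3⊎≡4⊎5≤ (h≥3 L))
  where
  grow : ∀ {d d′} → 4 * L ≤ sumBelow L h + d → 4 + d ≤ h L + d′ → 4 * suc L ≤ sumBelow (suc L) h + d′
  grow {d′ = d′} bound gain = subst (λ S → 4 * suc L ≤ S + d′) (sym (sumBelow-suc L h)) (4*-suc-≤ bound gain)
  step : Scan h L → h L ≡ 3 ⊎ h L ≡ 4 ⊎ 5 ≤ h L → Scan h (suc L)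
  step (run a<b b<L ha hb fours) _ = run a<b (m≤n⇒m≤1+n b<L) ha hb fours
  step (pending p<L hp fours bound) (inj₁ hL≡3) = run p<L ≤-refl hp hL≡3 fours
  step (pending {p} p<L hp fours bound) (inj₂ (inj₁ hL≡4)) =
    pending (m≤n⇒m≤1+n p<L) hp fours′ (grow bound (≤-reflexive (cong (_+ 1) (sym hL≡4))))
    where
    fours′ : FourBetween h p (suc L)
    fours′ s p<s s<1+L with m≤n⇒m<n∨m≡n (≤-pred s<1+L)
    ... | inj₁ s<L  = fours s p<s s<L
    ... | inj₂ refl = hL≡4
  step (pending p<L hp fours bound) (inj₂ (inj₂ 5≤hL)) = heavy (grow bound (≤-trans 5≤hL (m≤m+n _ 0)))
  step (heavy bound) (inj₁ hL≡3) =
    pending ≤-refl hL≡3 nothing-between (grow bound (≤-reflexive (cong (_+ 1) (sym hL≡3))))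
    where
    nothing-between : FourBetween h L (suc L)
    nothing-between s L<s s<1+L = contradiction (≤-pred s<1+L) (<⇒≱ L<s)
  step (heavy bound) (inj₂ (inj₁ hL≡4)) = heavy (grow bound (≤-reflexive (cong (_+ 0) (sym hL≡4))))
  step (heavy bound) (inj₂ (inj₂ 5≤hL)) = heavy (grow bound (≤-trans (≤-trans (n≤1+n 4) 5≤hL) (m≤m+n _ 0)))

sum<4k⇒∃≡3 : ∀ {k} {f : ℕ → ℕ} → (∀ i → 3 ≤ f i) → sumBelow k f < 4 * k → ∃ λ a → a < k × f a ≡ 3
sum<4k⇒∃≡3 {k} {f} f≥3 light with any? (λ (i : Fin k) → f (toℕ i) ≟ 3)
... | yes (i , fi≡3) = toℕ i , toℕ<n i , fi≡3
... | no  no-three   = contradiction 4k≤sum (<⇒≱ light)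
  where
  4k≤sum : 4 * k ≤ sumBelow k f
  4k≤sum = subst (_≤ sumBelow k f) (trans (sum-const k 4) (*-comm k 4))
             (sum-mono-≤ (λ i → ≤∧≢⇒< (f≥3 (toℕ i)) (λ 3≡fi → no-three (i , sym 3≡fi))))

four-elsewhere : ∀ {k} {f : ℕ → ℕ} → (∀ i → f (i + k) ≡ f i) → ∀ {a} → a < k →
                 FourBetween (λ s → f (a + s)) 0 k → ∀ b → b < k → b ≢ a → f b ≡ 4
four-elsewhere {k} {f} f-periodic {a} a<k fours b b<k b≢a with <-cmp b a
... | tri≈ _ b≡a _ = contradiction b≡a b≢a
... | tri> _ _ a<b = trans (cong f (sym (m+[n∸m]≡n (<⇒≤ a<b))))
                           (fours (b ∸ a) (m<n⇒0<n∸m a<b) (≤-trans (∸-monoˡ-< b<k (<⇒≤ a<b)) (m∸n≤m k a)))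
... | tri< b<a _ _ = trans (sym (f-periodic b)) (trans (cong f (sym a+s≡b+k)) (fours s (m<n⇒0<n∸m a<b+k) s<k))
  where
  a<b+k : a < b + k
  a<b+k = ≤-trans a<k (m≤n+m k b)
  s : ℕ
  s = b + k ∸ a
  a+s≡b+k : a + s ≡ b + k
  a+s≡b+k = m+[n∸m]≡n (<⇒≤ a<b+k)
  s<k : s < k
  s<k = +-cancelˡ-< a s k (subst (_< a + k) (sym a+s≡b+k) (+-monoˡ-< k b<a))

+3-too-light : ∀ {S k d} → S < 4 * k → d ≤ 1 → S + 3 + d < 4 * suc k
+3-too-light {S} {k} {d} S<4k d≤1 = begin-strict
  S + 3 + d  ≤⟨ +-monoʳ-≤ (S + 3) d≤1 ⟩
  S + 3 + 1  ≡⟨ solve (S ∷ []) ⟩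
  suc S + 3  ≤⟨ +-monoˡ-≤ 3 S<4k ⟩
  4 * k + 3  <⟨ +-monoʳ-< (4 * k) (n<1+n 3) ⟩
  4 * k + 4  ≡⟨ solve (k ∷ []) ⟩
  4 * suc k  ∎
  where open ≤-Reasoning

sum<4k⇒convenient : ∀ {k} {f : ℕ → ℕ} → (∀ i → f (i + k) ≡ f i) → (∀ i → 3 ≤ f i) →
                    sumBelow k f < 4 * k → Convenient f k
sum<4k⇒convenient {k} {f} f-periodic f≥3 light with sum<4k⇒∃≡3 f≥3 light
... | a₀ , a₀<k , fa₀≡3 = from-scan (scan (f≥3 ∘ (a₀ +_)) (suc k))
  where
  h : ℕ → ℕ
  h s = f (a₀ + s)
  sum-h : sumBelow (suc k) h ≡ sumBelow k f + 3
  sum-h = trans (sumBelow-suc k h) (cong₂ _+_ (sumBelow-rotate k f f-periodic a₀) (trans (f-periodic a₀) fa₀≡3))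
  too-light : ∀ {d} → d ≤ 1 → ¬ (4 * suc k ≤ sumBelow (suc k) h + d)
  too-light {d} d≤1 = <⇒≱ (subst (λ S → S + d < 4 * suc k) (sym sum-h) (+3-too-light light d≤1))
  from-scan : Scan h (suc k) → Convenient f k
  from-scan (pending _ _ _ bound) = contradiction bound (too-light ≤-refl)
  from-scan (heavy bound)         = contradiction bound (too-light z≤n)
  from-scan (run {a} {b} a<b b<1+k ha hb fours) with (b ∸ a) <? k
  ... | yes j<k = inj₂ (a₀ + a , b ∸ a , m<n⇒0<n∸m a<b , j<k , ha , hb′ , fours′)
    where
    a+j≡b : a + (b ∸ a) ≡ b
    a+j≡b = m+[n∸m]≡n (<⇒≤ a<b)
    hb′ : f (a₀ + a + (b ∸ a)) ≡ 3
    hb′ = trans (cong f (trans (+-assoc a₀ a _) (cong (a₀ +_) a+j≡b))) hb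
    fours′ : ∀ t → 1 ≤ t → t < b ∸ a → f (a₀ + a + t) ≡ 4
    fours′ t 1≤t t<j = trans (cong f (+-assoc a₀ a t))
      (fours (a + t) (subst (_< a + t) (+-identityʳ a) (+-monoʳ-< a 1≤t)) (subst (a + t <_) a+j≡b (+-monoʳ-< a t<j)))
  ... | no j≮k = inj₁ (a₀ , a₀<k , fa₀≡3 , four-elsewhere f-periodic a₀<k (subst₂ (FourBetween h) a≡0 b≡k fours))
    where
    b≤k : b ≤ k
    b≤k = ≤-pred b<1+k
    a+k≤b : a + k ≤ b
    a+k≤b = subst (a + k ≤_) (m+[n∸m]≡n (<⇒≤ a<b)) (+-monoʳ-≤ a (≮⇒≥ j≮k))
    a≡0 : a ≡ 0
    a≡0 = n≤0⇒n≡0 (+-cancelʳ-≤ k a 0 (≤-trans a+k≤b b≤k))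
    b≡k : b ≡ k
    b≡k = ≤-antisym b≤k (≤-trans (m≤n+m k a) a+k≤b)

-- Faces of a plane map

iter-+ : ∀ {A : Set} (f : A → A) a b x → iter f (a + b) x ≡ iter f a (iter f b x)
iter-+ f zero    b x = refl
iter-+ f (suc a) b x = cong f (iter-+ f a b x)

iter-*-period : ∀ {A : Set} (f : A → A) {s x} → iter f s x ≡ x → ∀ q → iter f (q * s) x ≡ x
iter-*-period f         closes zero    = refl
iter-*-period f {s} {x} closes (suc q) =
  trans (iter-+ f s (q * s) x) (trans (cong (iter f s) (iter-*-period f closes q)) closes)

iter-mod : ∀ {A : Set} (f : A → A) {s x} .{{_ : NonZero s}} → iter f s x ≡ x →
           ∀ a → iter f a x ≡ iter f (a % s) x
iter-mod f {s} {x} closes a = begin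
  iter f a x                                ≡⟨ cong (λ b → iter f b x) (m≡m%n+[m/n]*n a s) ⟩
  iter f (a % s + (a / s) * s) x            ≡⟨ iter-+ f (a % s) _ x ⟩
  iter f (a % s) (iter f ((a / s) * s) x)  ≡⟨ cong (iter f (a % s)) (iter-*-period f closes (a / s)) ⟩
  iter f (a % s) x                          ∎
  where open ≡-Reasoning

iter-period-shift : ∀ {A : Set} (f : A → A) {s x} → iter f s x ≡ x → ∀ i → iter f s (iter f i x) ≡ iter f i x
iter-period-shift f {s} {x} closes i = begin
  iter f s (iter f i x)  ≡⟨ iter-+ f s i x ⟨
  iter f (s + i) x       ≡⟨ cong (λ b → iter f b x) (+-comm s i) ⟩
  iter f (i + s) x       ≡⟨ iter-+ f i s x ⟩
  iter f i (iter f s x)  ≡⟨ cong (iter f i) closes ⟩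
  iter f i x             ∎
  where open ≡-Reasoning

argmin-below : ∀ s .{{_ : NonZero s}} (g : ℕ → ℕ) → ∃ λ i → i < s × ∀ j → j < s → g i ≤ g j
argmin-below 1             g = 0 , s≤s z≤n , λ { zero _ → ≤-refl ; (suc j) (s≤s ()) }
argmin-below (suc (suc s)) g with argmin-below (suc s) g
... | i , i<1+s , min with g i ≤? g (suc s)
...   | yes gi≤ = i , m≤n⇒m≤1+n i<1+s ,
                  λ j j<2+s → [ min j , (λ { refl → gi≤ }) ] (m≤n⇒m<n∨m≡n (≤-pred j<2+s))
...   | no  gi≰ = suc s , ≤-refl ,
                  λ j j<2+s → [ ≤-trans (<⇒≤ (≰⇒> gi≰)) ∘ min j , (λ { refl → ≤-refl }) ]
                                (m≤n⇒m<n∨m≡n (≤-pred j<2+s))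

module PlaneMapProperties (G : PlaneMap) where
  open PlaneMap G

  α-injective : Injective _≡_ _≡_ α
  α-injective {d} {e} αd≡αe = trans (sym (α-invol d)) (trans (cong α αd≡αe) (α-invol e))

  iter-φ-injective : ∀ i → Injective _≡_ _≡_ (iter φ i)
  iter-φ-injective zero    eq = eq
  iter-φ-injective (suc i) eq = iter-φ-injective i (α-injective (σ-inj eq))

  φ-no-fixpoint : ∀ d → φ d ≢ d
  φ-no-fixpoint d φd≡d = no-loop d (trans (sym (σ-tail (α d))) (cong tail φd≡d))

  deg-as-sum : ∀ v → deg v ≡ ∑[ d < m ] 𝟙 (tail d ≟ᶠ v)
  deg-as-sum v = length-filter-tabulate (λ d → tail d ≟ᶠ v) (λ d → d)

  handshake : ∑[ v < n ] deg v ≡ m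
  handshake = begin
    ∑[ v < n ] deg v
      ≡⟨ sum-cong-≗ {n} deg-as-sum ⟩
    ∑[ v < n ] ∑[ d < m ] 𝟙 (tail d ≟ᶠ v)
      ≡⟨ ∑-comm (λ v d → 𝟙 (tail d ≟ᶠ v)) ⟩
    ∑[ d < m ] ∑[ v < n ] 𝟙 (tail d ≟ᶠ v)
      ≡⟨ sum-cong-≗ {m} (λ d → sum-cong-≗ {n} (λ v → sym (*-identityʳ _))) ⟩
    ∑[ d < m ] ∑[ v < n ] (𝟙 (tail d ≟ᶠ v) * 1)
      ≡⟨ sum-cong-≗ {m} (λ d → sum-select (tail d) (λ _ → 1)) ⟩
    ∑[ d < m ] 1
      ≡⟨ trans (sum-const m 1) (*-identityʳ m) ⟩
    m
      ∎
    where open ≡-Reasoning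

  rep : Fin m → ℕ
  rep d = 𝟙 (faceRep? d)

  faces-as-sum : faces ≡ ∑[ d < m ] rep d
  faces-as-sum = length-filter-tabulate faceRep? (λ d → d)

  FaceRep : Fin m → Set
  FaceRep d = ∀ (i : Fin m) → toℕ d ≤ toℕ (iter φ (toℕ i) d)

  FaceRep-≤ : ∀ {d J} → FaceRep d → J < m → toℕ d ≤ toℕ (iter φ J d)
  FaceRep-≤ {d} d-rep J<m = subst (λ i → toℕ d ≤ toℕ (iter φ i d)) (toℕ-fromℕ< J<m) (d-rep (fromℕ< J<m))

  sum-orbit : ∀ s (w r : Fin m → ℕ) → (∀ i d → w (iter φ i d) ≡ w d) →
              ∑[ d < m ] (w d * sumBelow s (λ i → r (iter φ i d))) ≡ s * ∑[ d < m ] (w d * r d)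
  sum-orbit s w r w-invariant = begin
    ∑[ d < m ] (w d * sumBelow s (λ i → r (iter φ i d)))
      ≡⟨ sum-cong-≗ {m} (λ d → *-distribˡ-sum {s} (w d) _) ⟩
    ∑[ d < m ] ∑[ i < s ] (w d * r (φⁱ i d))
      ≡⟨ ∑-comm {m} {s} (λ d i → w d * r (φⁱ i d)) ⟩
    ∑[ i < s ] ∑[ d < m ] (w d * r (φⁱ i d))
      ≡⟨ sum-cong-≗ {s} (λ i → sum-cong-≗ {m} (λ d → cong (_* r (φⁱ i d)) (sym (w-invariant (toℕ i) d)))) ⟩
    ∑[ i < s ] ∑[ d < m ] (w (φⁱ i d) * r (φⁱ i d))
      ≡⟨ sum-cong-≗ {s} (λ i → sum-∘-injective (φⁱ i) (iter-φ-injective (toℕ i)) (λ d → w d * r d)) ⟩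
    ∑[ i < s ] ∑[ d < m ] (w d * r d)
      ≡⟨ sum-const s _ ⟩
    s * ∑[ d < m ] (w d * r d)
      ∎
    where
    open ≡-Reasoning
    φⁱ : Fin s → Fin m → Fin m
    φⁱ i = iter φ (toℕ i)

  module _ {x : Fin m} {s : ℕ} .{{_ : NonZero s}} (closes : iter φ s x ≡ x)
           (distinct : ∀ a b → a < s → b < s → iter φ a x ≡ iter φ b x → a ≡ b) where

    private
      orbit : ℕ → Fin m
      orbit i = iter φ i x

      s≤m : s ≤ m
      s≤m = injective⇒≤ {f = orbit ∘ toℕ} (λ eq → toℕ-injective (distinct _ _ (toℕ<n _) (toℕ<n _) eq))

      reaches : ∀ {i} j → i < s → ∃ λ J → J < s × iter φ J (orbit i) ≡ orbit j
      reaches {i} j i<s = J % s , m%n<n J s , (begin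
        iter φ (J % s) (orbit i)  ≡⟨ iter-mod φ {s} (iter-period-shift φ {s} closes i) J ⟨
        iter φ J (orbit i)        ≡⟨ iter-+ φ J i x ⟨
        orbit (J + i)             ≡⟨ cong orbit (m∸n+n≡m i≤j+s) ⟩
        orbit (j + s)             ≡⟨ iter-+ φ j s x ⟩
        iter φ j (orbit s)        ≡⟨ cong (iter φ j) closes ⟩
        orbit j                   ∎)
        where
        open ≡-Reasoning
        i≤j+s : i ≤ j + s
        i≤j+s = ≤-trans (<⇒≤ i<s) (m≤n+m s j)
        J : ℕ
        J = j + s ∸ i

      least : ∃ λ i → i < s × ∀ j → j < s → toℕ (orbit i) ≤ toℕ (orbit j)
      least = argmin-below s (toℕ ∘ orbit)

      i₀ : ℕ
      i₀ = proj₁ least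

      i₀<s : i₀ < s
      i₀<s = proj₁ (proj₂ least)

      i₀-least : ∀ j → j < s → toℕ (orbit i₀) ≤ toℕ (orbit j)
      i₀-least = proj₂ (proj₂ least)

      least-is-rep : FaceRep (orbit i₀)
      least-is-rep j = subst (λ d → toℕ (orbit i₀) ≤ toℕ d)
        (trans (sym (iter-mod φ {s} closes (toℕ j + i₀))) (iter-+ φ (toℕ j) i₀ x))
        (i₀-least _ (m%n<n (toℕ j + i₀) s))

      only-least-is-rep : ∀ i → i < s → FaceRep (orbit i) → i ≡ i₀
      only-least-is-rep i i<s i-rep = distinct i i₀ i<s i₀<s (toℕ-injective (≤-antisym i≤i₀ (i₀-least i i<s)))
        where
        i≤i₀ : toℕ (orbit i) ≤ toℕ (orbit i₀)
        i≤i₀ with reaches i₀ i<s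
        ... | J , J<s , reach = subst (λ d → toℕ (orbit i) ≤ toℕ d) reach (FaceRep-≤ i-rep (≤-trans J<s s≤m))

    rep-once-in-orbit : sumBelow s (λ i → rep (iter φ i x)) ≡ 1
    rep-once-in-orbit = trans
      (sumBelow-single s _ i₀<s (λ i i<s i≢i₀ → 𝟙-no (faceRep? _) (i≢i₀ ∘ only-least-is-rep i i<s)))
      (𝟙-yes (faceRep? _) least-is-rep)

-- Quilts

-- Euler's formula for c interior vertices, r triangles and k + 3r darts, with b the degree sum on
-- the boundary and δ the deficiency.
euler-bound : ∀ {c k r b δ} → 2 * (c + k) + 2 * (1 + r) ≡ k + 3 * r + 4 → 6 * c + b ≤ k + 3 * r + δ →
              δ ≤ 5 → b < 4 * k
euler-bound {c} {k} {r} {b} {δ} euler degrees δ≤5 = +-cancelʳ-≤ (3 * k + 9 * r + 11) _ _ (begin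
  suc b + (3 * k + 9 * r + 11)         ≡⟨ solve (k ∷ r ∷ b ∷ []) ⟩
  b + 3 * (k + 3 * r + 4)              ≡⟨ cong (λ e → b + 3 * e) euler ⟨
  b + 3 * (2 * (c + k) + 2 * (1 + r))  ≡⟨ solve (c ∷ k ∷ r ∷ b ∷ []) ⟩
  6 * c + b + (6 * k + 6 * r + 6)      ≤⟨ +-monoˡ-≤ _ (≤-trans degrees (+-monoʳ-≤ (k + 3 * r) δ≤5)) ⟩
  k + 3 * r + 5 + (6 * k + 6 * r + 6)  ≡⟨ solve (k ∷ r ∷ []) ⟩
  4 * k + (3 * k + 9 * r + 11)         ∎)
  where open ≤-Reasoning

module QuiltProperties (Q : Quilt) where
  open Quilt Q
  open PlaneMapProperties G

  instance
    k-nonZero : NonZero k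
    k-nonZero = >-nonZero (≤-trans (s≤s z≤n) k≥3)

  ∂ : ℕ → Fin m
  ∂ i = iter φ i outer

  ∂-periodic : ∀ i → ∂ (i + k) ≡ ∂ i
  ∂-periodic i = trans (iter-+ φ i k outer) (cong (iter φ i) k-closes)

  iter-∂ : ∀ a t → iter φ a (∂ t) ≡ iter φ t (∂ a)
  iter-∂ a t = trans (sym (iter-+ φ a t outer))
                     (trans (cong (λ j → iter φ j outer) (+-comm a t)) (iter-+ φ t a outer))

  cv-2+≢cv : ∀ i → cv (2 + i) ≢ cv i
  cv-2+≢cv i eq = below-k (i % k) (m%n<n i k) (subst₂ (λ d e → tail (φ (φ d)) ≡ tail e) ∂-mod ∂-mod eq)
    where
    ∂-mod : ∂ i ≡ ∂ (i % k)
    ∂-mod = iter-mod φ k-closes i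
    below-k : ∀ r → r < k → cv (2 + r) ≢ cv r
    below-k r r<k eq with 2 + r <? k
    ... | yes 2+r<k = 2+r≢r (cycle-distinct _ _ 2+r<k r<k eq)
      where
      2+r≢r : 2 + r ≢ r
      2+r≢r ()
    ... | no  2+r≮k = <⇒≢ k≥3 (sym k≡2)
      where
      t : ℕ
      t = 2 + r ∸ k
      t+k≡2+r : t + k ≡ 2 + r
      t+k≡2+r = m∸n+n≡m (≮⇒≥ 2+r≮k)
      t<k : t < k
      t<k = +-cancelʳ-< k t k (subst (_< k + k) (sym t+k≡2+r) (+-mono-≤-< (≤-trans (n≤1+n 2) k≥3) r<k))
      t≡r : t ≡ r
      t≡r = cycle-distinct t r t<k r<k (trans (cong tail (sym (∂-periodic t))) (trans (cong cv t+k≡2+r) eq))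
      k≡2 : k ≡ 2
      k≡2 = +-cancelʳ-≡ r k 2 (trans (cong (k +_) (sym t≡r)) (trans (+-comm k t) t+k≡2+r))

  2≤deg-cv : ∀ i → 2 ≤ deg (cv (suc i))
  2≤deg-cv i = subst (2 ≤_) (sym (deg-as-sum (cv (suc i))))
    (subst₂ (λ a b → a + b ≤ ∑[ d < m ] at d) (𝟙-yes (_ ≟ᶠ _) refl) (𝟙-yes (_ ≟ᶠ _) tail-α∂)
            (pair≤sum at ∂≢α∂))
    where
    at : Fin m → ℕ
    at d = 𝟙 (tail d ≟ᶠ cv (suc i))
    tail-α∂ : tail (α (∂ i)) ≡ cv (suc i)
    tail-α∂ = sym (σ-tail (α (∂ i)))
    ∂≢α∂ : ∂ (suc i) ≢ α (∂ i)
    ∂≢α∂ eq = cv-2+≢cv i (trans (σ-tail (α (∂ (suc i))))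
                               (trans (cong (tail ∘ α) eq) (cong tail (α-invol (∂ i)))))

  3≤deg-cv : (∀ v → deg v ≢ 2) → ∀ i → 3 ≤ deg (cv i)
  3≤deg-cv no-deg-2 i = subst (λ v → 3 ≤ deg v) cv-wraps (≤∧≢⇒< (2≤deg-cv (i + pred k)) (no-deg-2 _ ∘ sym))
    where
    cv-wraps : cv (suc (i + pred k)) ≡ cv i
    cv-wraps = trans (cong cv (trans (sym (+-suc i (pred k))) (cong (i +_) (suc-pred k)))) (cong tail (∂-periodic i))

  OnBoundary : Fin m → Set
  OnBoundary d = ∃ λ (i : Fin k) → ∂ (toℕ i) ≡ d

  onBoundary? : ∀ d → Dec (OnBoundary d)
  onBoundary? d = any? (λ i → ∂ (toℕ i) ≟ᶠ d)

  OnBoundary-φ : ∀ {d} → OnBoundary d → OnBoundary (φ d)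
  OnBoundary-φ (i , refl) with suc (toℕ i) <? k
  ... | yes 1+i<k = fromℕ< 1+i<k , cong ∂ (toℕ-fromℕ< 1+i<k)
  ... | no  1+i≮k = fromℕ< 0<k , trans (cong ∂ (toℕ-fromℕ< 0<k)) (trans (sym k-closes) (cong ∂ (sym 1+i≡k)))
    where
    0<k : 0 < k
    0<k = ≤-trans (s≤s z≤n) k≥3
    1+i≡k : suc (toℕ i) ≡ k
    1+i≡k = ≤-antisym (toℕ<n i) (≮⇒≥ 1+i≮k)

  ¬OnBoundary-φ : ∀ {d} → ¬ OnBoundary d → ¬ OnBoundary (φ d)
  ¬OnBoundary-φ {d} d∉ φd∈ = d∉ (subst OnBoundary (finite-triangles d d∉) (OnBoundary-φ (OnBoundary-φ φd∈)))

  OnBoundary-iter : ∀ i {d} → OnBoundary d → OnBoundary (iter φ i d)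
  OnBoundary-iter zero    d∈ = d∈
  OnBoundary-iter (suc i) d∈ = OnBoundary-φ (OnBoundary-iter i d∈)

  ¬OnBoundary-iter : ∀ i {d} → ¬ OnBoundary d → ¬ OnBoundary (iter φ i d)
  ¬OnBoundary-iter zero    d∉ = d∉
  ¬OnBoundary-iter (suc i) d∉ = ¬OnBoundary-φ (¬OnBoundary-iter i d∉)

  OnBoundary-iter⁻ : ∀ i {d} → OnBoundary (iter φ i d) → OnBoundary d
  OnBoundary-iter⁻ i {d} φⁱd∈ with onBoundary? d
  ... | yes d∈ = d∈
  ... | no  d∉ = contradiction φⁱd∈ (¬OnBoundary-iter i d∉)

  ifDec-onBoundary-iter : ∀ a b i d → ifDec (onBoundary? (iter φ i d)) a b ≡ ifDec (onBoundary? d) a b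
  ifDec-onBoundary-iter a b i d = ifDec-cong (OnBoundary-iter⁻ i) (OnBoundary-iter i) _ _ a b

  boundary-face : ∀ {d} → OnBoundary d → sumBelow k (λ i → rep (iter φ i d)) ≡ 1
  boundary-face (t , refl) = rep-once-in-orbit (iter-period-shift φ {k} k-closes (toℕ t)) distinct
    where
    distinct : ∀ a b → a < k → b < k → iter φ a (∂ (toℕ t)) ≡ iter φ b (∂ (toℕ t)) → a ≡ b
    distinct a b a<k b<k eq = cycle-distinct a b a<k b<k
      (cong tail (iter-φ-injective (toℕ t) (trans (sym (iter-∂ a (toℕ t))) (trans eq (iter-∂ b (toℕ t))))))

  inner-face : ∀ {d} → ¬ OnBoundary d → sumBelow 3 (λ i → rep (iter φ i d)) ≡ 1
  inner-face {d} d∉ = rep-once-in-orbit (finite-triangles d d∉) distinct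
    where
    φ²d≢d : φ (φ d) ≢ d
    φ²d≢d eq = φ-no-fixpoint d (trans (sym (cong φ eq)) (finite-triangles d d∉))
    distinct : ∀ a b → a < 3 → b < 3 → iter φ a d ≡ iter φ b d → a ≡ b
    distinct 0 0 _ _ _  = refl
    distinct 1 1 _ _ _  = refl
    distinct 2 2 _ _ _  = refl
    distinct 0 1 _ _ eq = contradiction (sym eq) (φ-no-fixpoint d)
    distinct 1 0 _ _ eq = contradiction eq (φ-no-fixpoint d)
    distinct 1 2 _ _ eq = contradiction (sym eq) (φ-no-fixpoint (φ d))
    distinct 2 1 _ _ eq = contradiction eq (φ-no-fixpoint (φ d))
    distinct 0 2 _ _ eq = contradiction (sym eq) φ²d≢d
    distinct 2 0 _ _ eq = contradiction eq φ²d≢d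
    distinct (suc (suc (suc _))) _ (s≤s (s≤s (s≤s ()))) _ _
    distinct _ (suc (suc (suc _))) _ (s≤s (s≤s (s≤s ()))) _

  isBoundary isInner : Fin m → ℕ
  isBoundary d = ifDec (onBoundary? d) 1 0
  isInner    d = ifDec (onBoundary? d) 0 1

  innerFaces : ℕ
  innerFaces = ∑[ d < m ] (isInner d * rep d)

  ∂-injective : Injective _≡_ _≡_ (∂ ∘ toℕ {k})
  ∂-injective eq = toℕ-injective (cycle-distinct _ _ (toℕ<n _) (toℕ<n _) (cong tail eq))

  boundary-faces : ∑[ d < m ] (isBoundary d * rep d) ≡ 1
  boundary-faces = *-cancelˡ-≡ _ 1 k (begin
    k * ∑[ d < m ] (isBoundary d * rep d)
      ≡⟨ sum-orbit k isBoundary rep (ifDec-onBoundary-iter 1 0) ⟨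
    ∑[ d < m ] (isBoundary d * sumBelow k (λ i → rep (iter φ i d)))
      ≡⟨ sum-cong-≗ {m} one-face ⟩
    ∑[ d < m ] isBoundary d
      ≡⟨ count-image (∂ ∘ toℕ) ∂-injective onBoundary? ⟩
    k
      ≡⟨ *-identityʳ k ⟨
    k * 1
      ∎)
    where
    open ≡-Reasoning
    one-face : ∀ d → isBoundary d * sumBelow k (λ i → rep (iter φ i d)) ≡ isBoundary d
    one-face d with onBoundary? d
    ... | yes d∈ = trans (+-identityʳ _) (boundary-face d∈)
    ... | no  _  = refl

  darts-count : m ≡ k + 3 * innerFaces
  darts-count = begin
    m
      ≡⟨ trans (sum-const m 1) (*-identityʳ m) ⟨
    ∑[ d < m ] 1
      ≡⟨ sum-cong-≗ {m} one-face ⟨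
    ∑[ d < m ] (isBoundary d * Σᵏ d + isInner d * Σ³ d)
      ≡⟨ ∑-distrib-+ {m} _ _ ⟩
    ∑[ d < m ] (isBoundary d * Σᵏ d) + ∑[ d < m ] (isInner d * Σ³ d)
      ≡⟨ cong₂ _+_ (sum-orbit k isBoundary rep (ifDec-onBoundary-iter 1 0))
                   (sum-orbit 3 isInner rep (ifDec-onBoundary-iter 0 1)) ⟩
    k * ∑[ d < m ] (isBoundary d * rep d) + 3 * innerFaces
      ≡⟨ cong (λ x → k * x + 3 * innerFaces) boundary-faces ⟩
    k * 1 + 3 * innerFaces
      ≡⟨ cong (_+ 3 * innerFaces) (*-identityʳ k) ⟩
    k + 3 * innerFaces
      ∎
    where
    open ≡-Reasoning
    Σᵏ Σ³ : Fin m → ℕ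
    Σᵏ d = sumBelow k (λ i → rep (iter φ i d))
    Σ³ d = sumBelow 3 (λ i → rep (iter φ i d))
    one-face : ∀ d → isBoundary d * Σᵏ d + isInner d * Σ³ d ≡ 1
    one-face d with onBoundary? d
    ... | yes d∈ = trans (+-identityʳ _) (trans (+-identityʳ _) (boundary-face d∈))
    ... | no  d∉ = trans (+-identityʳ _) (inner-face d∉)

  faces-count : faces ≡ 1 + innerFaces
  faces-count = begin
    faces                                                  ≡⟨ faces-as-sum ⟩
    ∑[ d < m ] rep d                                       ≡⟨ sum-cong-≗ {m} split ⟨
    ∑[ d < m ] (isBoundary d * rep d + isInner d * rep d)  ≡⟨ ∑-distrib-+ {m} _ _ ⟩
    ∑[ d < m ] (isBoundary d * rep d) + innerFaces         ≡⟨ cong (_+ innerFaces) boundary-faces ⟩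
    1 + innerFaces                                         ∎
    where
    open ≡-Reasoning
    split : ∀ d → isBoundary d * rep d + isInner d * rep d ≡ rep d
    split d with onBoundary? d
    ... | yes _ = trans (+-identityʳ _) (+-identityʳ _)
    ... | no  _ = +-identityʳ _

  interiorVertices : ℕ
  interiorVertices = ∑[ v < n ] ifDec (onC? v) 0 1

  cv-injective : Injective _≡_ _≡_ (cv ∘ toℕ {k})
  cv-injective eq = toℕ-injective (cycle-distinct _ _ (toℕ<n _) (toℕ<n _) eq)

  vertex-count : interiorVertices + k ≡ n
  vertex-count = begin
    interiorVertices + k
      ≡⟨ cong (interiorVertices +_) (count-image (cv ∘ toℕ) cv-injective onC?) ⟨
    interiorVertices + ∑[ v < n ] 𝟙 (onC? v)
      ≡⟨ ∑-distrib-+ {n} _ _ ⟨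
    ∑[ v < n ] (ifDec (onC? v) 0 1 + 𝟙 (onC? v))
      ≡⟨ sum-cong-≗ {n} (λ v → split (onC? v)) ⟩
    ∑[ v < n ] 1
      ≡⟨ trans (sum-const n 1) (*-identityʳ n) ⟩
    n
      ∎
    where
    open ≡-Reasoning
    split : ∀ {P : Set} (P? : Dec P) → ifDec P? 0 1 + 𝟙 P? ≡ 1
    split (yes _) = refl
    split (no _)  = refl

  degree-bound : 6 * interiorVertices + sumBelow k (λ i → deg (cv i)) ≤ m + deficiency
  degree-bound = begin
    6 * interiorVertices + sumBelow k (λ i → deg (cv i))
      ≡⟨ cong₂ _+_ (*-distribˡ-sum {n} 6 _) (sym (sum-image (cv ∘ toℕ) cv-injective onC? deg)) ⟩
    ∑[ v < n ] (6 * ifDec (onC? v) 0 1) + ∑[ v < n ] (𝟙 (onC? v) * deg v)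
      ≡⟨ ∑-distrib-+ {n} _ _ ⟨
    ∑[ v < n ] (6 * ifDec (onC? v) 0 1 + 𝟙 (onC? v) * deg v)
      ≤⟨ sum-mono-≤ (λ v → vertex-bound (onC? v) (deg v)) ⟩
    ∑[ v < n ] (deg v + defTerm v)
      ≡⟨ ∑-distrib-+ {n} _ _ ⟩
    ∑[ v < n ] deg v + ∑[ v < n ] defTerm v
      ≡⟨ cong₂ _+_ handshake (sym (sum-map-tabulate defTerm (λ v → v))) ⟩
    m + deficiency
      ∎
    where
    open ≤-Reasoning
    vertex-bound : ∀ {P : Set} (P? : Dec P) x → 6 * ifDec P? 0 1 + 𝟙 P? * x ≤ x + ifDec P? 0 (6 ∸ x)
    vertex-bound (yes _) x = ≤-reflexive (trans (+-identityʳ x) (sym (+-identityʳ x)))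
    vertex-bound (no _)  x = m≤n+m∸n 6 x

  boundary-degree-bound : sumBelow k (λ i → deg (cv i)) < 4 * k
  boundary-degree-bound = euler-bound {interiorVertices} {k} {innerFaces} euler degrees deficiency≤5
    where
    open ≡-Reasoning
    euler : 2 * (interiorVertices + k) + 2 * (1 + innerFaces) ≡ k + 3 * innerFaces + 4
    euler = begin
      2 * (interiorVertices + k) + 2 * (1 + innerFaces)
        ≡⟨ cong₂ (λ v f → 2 * v + 2 * f) vertex-count (sym faces-count) ⟩
      2 * n + 2 * faces
        ≡⟨ planar ⟩
      m + 4
        ≡⟨ cong (_+ 4) darts-count ⟩
      k + 3 * innerFaces + 4
        ∎
    degrees : 6 * interiorVertices + sumBelow k (λ i → deg (cv i)) ≤ k + 3 * innerFaces + deficiency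
    degrees = subst (λ e → 6 * interiorVertices + sumBelow k (λ i → deg (cv i)) ≤ e + deficiency)
                    darts-count degree-bound

lemma7p1 : (Q : Quilt) → (∀ v → PlaneMap.deg (Quilt.G Q) v ≢ 2) → HasConvenientGraph Q
lemma7p1 Q no-deg-2 =
  sum<4k⇒convenient (λ i → cong (deg ∘ tail) (∂-periodic i)) (3≤deg-cv no-deg-2) boundary-degree-bound
  where
  open Quilt Q
  open QuiltProperties Q
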